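{- For any integer $n\ge 3$ with $n\ne 4$, there exists a connected graph $G$ such that $G_{SR}\cong C_n$.
   Context: All graphs are finite, simple and undirected; $d_G$ is the distance in $G$. A vertex $u$ is maximally distant from $v$ if $d_G(v,w)\le d_G(u,v)$ for every neighbor $w$ of $u$. Vertices $u,v$ are mutually maximally distant (MMD) if each is maximally distant from the other. The boundary $\partial(G)$ is the set of vertices maximally distant from some vertex of $G$. The strong resolving graph $G_{SR}$ (defined for connected $G$) has vertex set $\partial(G)$, two vertices being adjacent iff they are MMD in $G$. $C_n$ is the cycle on $n$ vertices. -}

module Defs where

open import Data.Nat using (ℕ; zero; suc; _≤_; _%_)
open import Data.Fin using (Fin; toℕ)
open import Data.Bool using (Bool; true; false)
open import Data.Product using (Σ; ∃; _×_; _,_)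
open import Data.Sum using (_⊎_)
open import Relation.Binary.PropositionalEquality using (_≡_)
open import Function.Bundles using (_⇔_)

record Graph : Set where
  field
    order : ℕ
    adj   : Fin order → Fin order → Bool
    sym   : ∀ u v → adj u v ≡ adj v u
    irrefl : ∀ u → adj u u ≡ false

open Graph public

module _ (G : Graph) where
  V : Set
  V = Fin (order G)

  Adj : V → V → Set
  Adj u v = adj G u v ≡ true

  data Walk : V → V → ℕ → Set where
    here : ∀ {u} → Walk u u zero
    step : ∀ {u w v k} → Adj u w → Walk w v k → Walk u v (suc k)

  Connected : Set
  Connected = ∀ u v → ∃ λ k → Walk u v k

  Dist : V → V → ℕ → Set
  Dist u v k = Walk u v k × (∀ j → Walk u v j → k ≤ j)

  MaxDist : V → V → Set
  MaxDist u v = ∀ w → Adj u w → ∀ a b → Dist v w a → Dist u v b → a ≤ b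

  MMD : V → V → Set
  MMD u v = MaxDist u v × MaxDist v u

  InBoundary : V → Set
  InBoundary u = ∃ λ v → MaxDist u v

  -- G_SR ≅ C_n : a bijection f : Fin n → ∂(G) with
  --   f i, f j MMD in G  ⇔  i, j adjacent in the cycle 0-1-...-(n-1)-0
  SRIsoCycle : ℕ → Set
  SRIsoCycle n =
    Σ (Fin n → V) λ f →
      (∀ i → InBoundary (f i)) ×
      (∀ i j → f i ≡ f j → i ≡ j) ×
      (∀ u → InBoundary u → ∃ λ i → f i ≡ u) ×
      (∀ i j → MMD (f i) (f j) ⇔ CycleAdj n i j)
    where
      CycleAdj : (n : ℕ) → Fin n → Fin n → Set
      CycleAdj zero () _
      CycleAdj (suc n') i j =
        toℕ j ≡ suc (toℕ i) % suc n' ⊎ toℕ i ≡ suc (toℕ j) % suc n'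

-- For n = 3 take the triangle K₃: every two distinct vertices are at distance 1 = diameter, so
-- they are mutually maximally distant, while no vertex is maximally distant from itself.
-- For n ≥ 5 take the complement of Cₙ. It has diameter 2: two consecutive cycle vertices x, x+1
-- have the common neighbour x+3. Consecutive pairs are at distance 2 = diameter, hence MMD.
-- If u, v are adjacent, one of v+1, v-1 is a neighbour of u (otherwise u = v+2 and v = u+2,
-- i.e. u = u+4), and that neighbour is at distance 2 from v, so u is not maximally distant from v.
-- Thus in both graphs G_SR is the cycle itself.
module Submission where

open import Defs hiding (sym)
open import Data.Nat using (ℕ; zero; suc; _+_; _*_; _/_; _%_; _≤_; _<_; z≤n; s≤s; NonZero)
import Data.Nat as ℕ
open import Data.Nat.Properties
  using (≤-refl; ≤-trans; <-trans; <-irrefl; <⇒≱; n<1+n; m<n⇒m<1+n; +-suc; +-identityʳ; +-cancelˡ-≡; m+n≮m)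
open import Data.Nat.DivMod
  using (m%n<n; m<n⇒m%n≡m; m%n%n≡m%n; [m+n]%n≡m%n; %-distribˡ-+; m≡m%n+[m/n]*n)
open import Data.Fin using (Fin; toℕ; fromℕ<; _≟_)
open import Data.Fin.Properties using (toℕ-fromℕ<; toℕ-injective; toℕ<n)
import Data.Bool as Bool
open import Data.Product using (Σ; ∃; _×_; _,_; proj₁; proj₂)
open import Data.Sum using (_⊎_; inj₁; inj₂; swap; reduce)
import Data.Sum as Sum
open import Data.Empty using (⊥; ⊥-elim)
open import Relation.Nullary using (¬_; Dec; yes; no)
open import Relation.Nullary.Decidable using (does; dec-true; dec-false; does-⇔; ¬?; _×-dec_; _⊎-dec_)
open import Relation.Binary.Definitions using (Decidable; Symmetric)
open import Relation.Binary.PropositionalEquality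
  using (_≡_; _≢_; refl; sym; trans; cong; ≢-sym; module ≡-Reasoning)
open import Function.Bundles using (_⇔_; mk⇔; Equivalence)
open import Function.Properties.Equivalence using () renaming (trans to ⇔-trans)

module _ (G : Graph) where
  private variable
    u v w : V G
    a b d k : ℕ

  Adj-sym : Adj G u v → Adj G v u
  Adj-sym {u} {v} uv = trans (Graph.sym G v u) uv

  Adj⇒≢ : Adj G u v → u ≢ v
  Adj⇒≢ {u} uu refl with trans (sym uu) (Graph.irrefl G u)
  ... | ()

  common-neighbour⇒walk₂ : Adj G u w → Adj G v w → Walk G u v 2
  common-neighbour⇒walk₂ uw vw = step uw (step (Adj-sym vw) here)

  walk-length≥1 : u ≢ v → Walk G u v k → 1 ≤ k
  walk-length≥1 u≢v here       = ⊥-elim (u≢v refl)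
  walk-length≥1 u≢v (step _ _) = s≤s z≤n

  walk-length≥2 : u ≢ v → ¬ Adj G u v → Walk G u v k → 2 ≤ k
  walk-length≥2 u≢v _    here                = ⊥-elim (u≢v refl)
  walk-length≥2 _   ¬uv  (step uw here)      = ⊥-elim (¬uv uw)
  walk-length≥2 _   _    (step _ (step _ _)) = s≤s (s≤s z≤n)

  Dist-refl : Dist G u u 0
  Dist-refl = here , λ _ _ → z≤n

  Adj⇒Dist₁ : Adj G u v → Dist G u v 1
  Adj⇒Dist₁ uv = step uv here , λ _ → walk-length≥1 (Adj⇒≢ uv)

  Diameter≤ : ℕ → Set
  Diameter≤ d = ∀ u v → ∃ λ k → k ≤ d × Walk G u v k

  Diameter≤⇒Connected : Diameter≤ d → Connected G
  Diameter≤⇒Connected diam u v = let k , _ , uv = diam u v in k , uv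

  Dist≤diameter : Diameter≤ d → Dist G u v a → a ≤ d
  Dist≤diameter {u = u} {v} diam (_ , shortest) =
    let k , k≤d , uv = diam u v in ≤-trans (shortest k uv) k≤d

  MaxDist-at-diameter : Diameter≤ d → (∀ k → Walk G u v k → d ≤ k) → MaxDist G u v
  MaxDist-at-diameter diam far _ _ _ _ vw (uv , _) = ≤-trans (Dist≤diameter diam vw) (far _ uv)

  farther-neighbour⇒¬MaxDist : Adj G u w → Dist G v w a → Dist G u v b → b < a → ¬ MaxDist G u v
  farther-neighbour⇒¬MaxDist uw vw uv b<a maxDist = <⇒≱ b<a (maxDist _ uw _ _ vw uv)

  ¬MaxDist-self : Adj G u w → ¬ MaxDist G u u
  ¬MaxDist-self uw = farther-neighbour⇒¬MaxDist uw (Adj⇒Dist₁ uw) Dist-refl (s≤s z≤n)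

module RelationGraph {n : ℕ} {R : Fin n → Fin n → Set}
                     (R? : Decidable R) (R-sym : Symmetric R) (R-irrefl : ∀ u → ¬ R u u) where

  graph : Graph
  graph = record
    { order  = n
    ; adj    = λ u v → does (R? u v)
    ; sym    = λ u v → does-⇔ (mk⇔ R-sym R-sym) (R? u v) (R? v u)
    ; irrefl = λ u → dec-false (R? u u) (R-irrefl u)
    }

  R⇒Adj : ∀ {u v} → R u v → Adj graph u v
  R⇒Adj {u} {v} = dec-true (R? u v)

  Adj⇒R : ∀ {u v} → Adj graph u v → R u v
  Adj⇒R {u} {v} uv with R? u v
  Adj⇒R _  | yes r = r
  Adj⇒R () | no _

  Adj? : ∀ u v → Dec (Adj graph u v)
  Adj? u v = does (R? u v) Bool.≟ Bool.true

[1+m%n]%n≡[1+m]%n : ∀ m n .{{_ : NonZero n}} → suc (m % n) % n ≡ suc m % n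
[1+m%n]%n≡[1+m]%n m n = begin
  (1 + m % n) % n           ≡⟨ %-distribˡ-+ 1 (m % n) n ⟩
  (1 % n + m % n % n) % n   ≡⟨ cong (λ r → (1 % n + r) % n) (m%n%n≡m%n m n) ⟩
  (1 % n + m % n) % n       ≡⟨ %-distribˡ-+ 1 m n ⟨
  (1 + m) % n               ∎
  where open ≡-Reasoning

[m+k]%n≢m : ∀ m {k n} .{{_ : NonZero n}} → 0 < k → k < n → (m + k) % n ≢ m
[m+k]%n≢m m {k} {n} 0<k k<n eq = k≢q*n ((m + k) / n) (+-cancelˡ-≡ m k _ m+k≡m+q*n)
  where
  m+k≡m+q*n : m + k ≡ m + (m + k) / n * n
  m+k≡m+q*n = trans (m≡m%n+[m/n]*n (m + k) n) (cong (_+ (m + k) / n * n) eq)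
  k≢q*n : ∀ q → k ≢ q * n
  k≢q*n zero    refl = <-irrefl refl 0<k
  k≢q*n (suc q) refl = m+n≮m n (q * n) k<n

module _ {N : ℕ} where
  private variable
    x y : Fin (suc N)
    k : ℕ

  next : Fin (suc N) → Fin (suc N)
  next x = fromℕ< (m%n<n (suc (toℕ x)) (suc N))

  toℕ-next : ∀ x → toℕ (next x) ≡ suc (toℕ x) % suc N
  toℕ-next x = toℕ-fromℕ< (m%n<n (suc (toℕ x)) (suc N))

  next^ : ℕ → Fin (suc N) → Fin (suc N)
  next^ zero    x = x
  next^ (suc k) x = next (next^ k x)

  toℕ-next^ : ∀ k x → toℕ (next^ k x) ≡ (toℕ x + k) % suc N
  toℕ-next^ zero x = begin
    toℕ x                ≡⟨ m<n⇒m%n≡m (toℕ<n x) ⟨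
    toℕ x % suc N        ≡⟨ cong (_% suc N) (+-identityʳ (toℕ x)) ⟨
    (toℕ x + 0) % suc N  ∎
    where open ≡-Reasoning
  toℕ-next^ (suc k) x = begin
    toℕ (next (next^ k x))             ≡⟨ toℕ-next (next^ k x) ⟩
    suc (toℕ (next^ k x)) % suc N      ≡⟨ cong (λ r → suc r % suc N) (toℕ-next^ k x) ⟩
    suc ((toℕ x + k) % suc N) % suc N  ≡⟨ [1+m%n]%n≡[1+m]%n (toℕ x + k) (suc N) ⟩
    suc (toℕ x + k) % suc N            ≡⟨ cong (_% suc N) (+-suc (toℕ x) k) ⟨
    (toℕ x + suc k) % suc N            ∎
    where open ≡-Reasoning

  next^-≢ : ∀ k x → 0 < k → k < suc N → next^ k x ≢ x
  next^-≢ k x 0<k k<n eq = [m+k]%n≢m (toℕ x) 0<k k<n (trans (sym (toℕ-next^ k x)) (cong toℕ eq))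

  next^-period : ∀ x → next^ (suc N) x ≡ x
  next^-period x = toℕ-injective (begin
    toℕ (next^ (suc N) x)    ≡⟨ toℕ-next^ (suc N) x ⟩
    (toℕ x + suc N) % suc N  ≡⟨ [m+n]%n≡m%n (toℕ x) (suc N) ⟩
    toℕ x % suc N            ≡⟨ m<n⇒m%n≡m (toℕ<n x) ⟩
    toℕ x                    ∎)
    where open ≡-Reasoning

  next^-next : ∀ k x → next^ k (next x) ≡ next (next^ k x)
  next^-next zero    x = refl
  next^-next (suc k) x = cong next (next^-next k x)

  next-injective : next x ≡ next y → x ≡ y
  next-injective {x} {y} eq = begin
    x                   ≡⟨ next^-period x ⟨
    next (next^ N x)    ≡⟨ next^-next N x ⟨
    next^ N (next x)    ≡⟨ cong (next^ N) eq ⟩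
    next^ N (next y)    ≡⟨ next^-next N y ⟩
    next (next^ N y)    ≡⟨ next^-period y ⟩
    y                   ∎
    where open ≡-Reasoning

  prev : Fin (suc N) → Fin (suc N)
  prev = next^ N

  next-prev : ∀ x → next (prev x) ≡ x
  next-prev = next^-period

  -- Definitionally equal to the cycle adjacency inside SRIsoCycle, which Defs does not export.
  CycleAdj : Fin (suc N) → Fin (suc N) → Set
  CycleAdj x y = toℕ y ≡ suc (toℕ x) % suc N ⊎ toℕ x ≡ suc (toℕ y) % suc N

  CycleAdj? : Decidable CycleAdj
  CycleAdj? x y = (toℕ y ℕ.≟ suc (toℕ x) % suc N) ⊎-dec (toℕ x ℕ.≟ suc (toℕ y) % suc N)

  CycleAdj-sym : Symmetric CycleAdj
  CycleAdj-sym = swap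

  CycleAdj⇔next : CycleAdj x y ⇔ (y ≡ next x ⊎ x ≡ next y)
  CycleAdj⇔next {x} {y} = mk⇔
    (Sum.map (λ eq → toℕ-injective (trans eq (sym (toℕ-next x))))
             (λ eq → toℕ-injective (trans eq (sym (toℕ-next y)))))
    (Sum.map (λ { refl → toℕ-next x }) (λ { refl → toℕ-next y }))

  CycleAdj-next : ∀ x → CycleAdj x (next x)
  CycleAdj-next x = inj₁ (toℕ-next x)

  MMD⇔CycleAdj⇒SRIsoCycle : (G : Graph) (f : Fin (suc N) → V G) →
    (∀ i j → f i ≡ f j → i ≡ j) → (∀ u → ∃ λ i → f i ≡ u) →
    (∀ i j → MMD G (f i) (f j) ⇔ CycleAdj i j) → SRIsoCycle G (suc N)
  MMD⇔CycleAdj⇒SRIsoCycle G f f-injective f-surjective MMD⇔ =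
    f , boundary , f-injective , (λ u _ → f-surjective u) , MMD⇔
    where
    boundary : ∀ i → InBoundary G (f i)
    boundary i = f (next i) , proj₁ (Equivalence.from (MMD⇔ i (next i)) (CycleAdj-next i))

private module Complete (n : ℕ) = RelationGraph {n} (λ u v → ¬? (u ≟ v)) ≢-sym (λ u u≢u → u≢u refl)

complete : ℕ → Graph
complete = Complete.graph

module _ {n : ℕ} where
  open Complete n

  complete-diameter≤1 : Diameter≤ (complete n) 1
  complete-diameter≤1 u v with u ≟ v
  ... | yes refl = 0 , z≤n , here
  ... | no u≢v   = 1 , ≤-refl , step (R⇒Adj u≢v) here

  complete-MaxDist : ∀ {u v} → u ≢ v → MaxDist (complete n) u v
  complete-MaxDist u≢v = MaxDist-at-diameter _ complete-diameter≤1 (λ _ → walk-length≥1 _ u≢v)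

  complete-¬MaxDist-self : ∀ {u w} → w ≢ u → ¬ MaxDist (complete n) u u
  complete-¬MaxDist-self w≢u = ¬MaxDist-self _ (R⇒Adj (≢-sym w≢u))

complete-MMD⇔≢ : ∀ {m} (u v : Fin (2 + m)) → MMD (complete (2 + m)) u v ⇔ u ≢ v
complete-MMD⇔≢ u v = mk⇔ MMD⇒≢ (λ u≢v → complete-MaxDist u≢v , complete-MaxDist (≢-sym u≢v))
  where
  open Data.Fin using (zero; suc)
  MMD⇒≢ : MMD (complete _) u v → u ≢ v
  MMD⇒≢ (maxDist , _) refl = complete-¬MaxDist-self (proj₂ (another u)) maxDist
    where
    another : ∀ {m} (u : Fin (2 + m)) → ∃ λ w → w ≢ u
    another zero    = suc zero , λ ()
    another (suc _) = zero , λ ()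

≢⇔CycleAdj₃ : (i j : Fin 3) → i ≢ j ⇔ CycleAdj i j
≢⇔CycleAdj₃ i j = mk⇔ (≢⇒CycleAdj i j) (CycleAdj⇒≢ i j)
  where
  open Data.Fin using (zero; suc)
  ≢⇒CycleAdj : (i j : Fin 3) → i ≢ j → CycleAdj i j
  ≢⇒CycleAdj zero             (suc zero)       _ = inj₁ refl
  ≢⇒CycleAdj zero             (suc (suc zero)) _ = inj₂ refl
  ≢⇒CycleAdj (suc zero)       zero             _ = inj₂ refl
  ≢⇒CycleAdj (suc zero)       (suc (suc zero)) _ = inj₁ refl
  ≢⇒CycleAdj (suc (suc zero)) zero             _ = inj₁ refl
  ≢⇒CycleAdj (suc (suc zero)) (suc zero)       _ = inj₂ refl
  ≢⇒CycleAdj zero             zero             i≢i = ⊥-elim (i≢i refl)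
  ≢⇒CycleAdj (suc zero)       (suc zero)       i≢i = ⊥-elim (i≢i refl)
  ≢⇒CycleAdj (suc (suc zero)) (suc (suc zero)) i≢i = ⊥-elim (i≢i refl)
  CycleAdj⇒≢ : (i j : Fin 3) → CycleAdj i j → i ≢ j
  CycleAdj⇒≢ zero             _ (inj₁ ()) refl
  CycleAdj⇒≢ zero             _ (inj₂ ()) refl
  CycleAdj⇒≢ (suc zero)       _ (inj₁ ()) refl
  CycleAdj⇒≢ (suc zero)       _ (inj₂ ()) refl
  CycleAdj⇒≢ (suc (suc zero)) _ (inj₁ ()) refl
  CycleAdj⇒≢ (suc (suc zero)) _ (inj₂ ()) refl

K₃-SRIsoCycle : SRIsoCycle (complete 3) 3
K₃-SRIsoCycle = MMD⇔CycleAdj⇒SRIsoCycle (complete 3) (λ i → i) (λ _ _ eq → eq) (λ u → u , refl)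
  (λ i j → ⇔-trans (complete-MMD⇔≢ i j) (≢⇔CycleAdj₃ i j))

module CycleComplement (N : ℕ) (4≤N : 4 ≤ N) where
  private variable
    x y : Fin (suc N)

  NonCycleAdj : Fin (suc N) → Fin (suc N) → Set
  NonCycleAdj x y = x ≢ y × ¬ CycleAdj x y

  open RelationGraph {suc N} {NonCycleAdj}
         (λ x y → ¬? (x ≟ y) ×-dec ¬? (CycleAdj? x y))
         (λ (x≢y , ¬xy) → ≢-sym x≢y , λ yx → ¬xy (CycleAdj-sym yx))
         (λ x (x≢x , _) → x≢x refl)
    public

  CycleAdj⇒≢ : CycleAdj x y → x ≢ y
  CycleAdj⇒≢ {x} xx refl =
    next^-≢ 1 x (s≤s z≤n) (s≤s (≤-trans (s≤s z≤n) 4≤N)) (sym (reduce (Equivalence.to CycleAdj⇔next xx)))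

  next^-Adj : ∀ k x → 2 ≤ k → k < N → Adj graph x (next^ k x)
  next^-Adj (suc k) x (s≤s 1≤k) k<N = R⇒Adj (≢-sym (next^-≢ (suc k) x (s≤s z≤n) k<n) , ¬cycle)
    where
    k<n : suc k < suc N
    k<n = m<n⇒m<1+n k<N
    ¬cycle : ¬ CycleAdj x (next^ (suc k) x)
    ¬cycle c with Equivalence.to CycleAdj⇔next c
    ... | inj₁ eq = next^-≢ k x 1≤k (<-trans (n<1+n k) k<n) (next-injective eq)
    ... | inj₂ eq = next^-≢ (suc (suc k)) x (s≤s z≤n) (s≤s k<N) (sym eq)

  next^3-common-neighbour : ∀ x → Adj graph x (next^ 3 x) × Adj graph (next x) (next^ 3 x)
  next^3-common-neighbour x =
    next^-Adj 3 x (s≤s (s≤s z≤n)) 4≤N , next^-Adj 2 (next x) (s≤s (s≤s z≤n)) (<-trans (n<1+n 2) 4≤N)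

  CycleAdj⇒walk₂ : CycleAdj x y → Walk graph x y 2
  CycleAdj⇒walk₂ {x} {y} xy with Equivalence.to CycleAdj⇔next xy
  ... | inj₁ refl = let x~x+3 , x+1~x+3 = next^3-common-neighbour x
                    in common-neighbour⇒walk₂ graph x~x+3 x+1~x+3
  ... | inj₂ refl = let y~y+3 , y+1~y+3 = next^3-common-neighbour y
                    in common-neighbour⇒walk₂ graph y+1~y+3 y~y+3

  CycleAdj⇒Dist₂ : CycleAdj x y → Dist graph x y 2
  CycleAdj⇒Dist₂ xy =
    CycleAdj⇒walk₂ xy , λ _ → walk-length≥2 graph (CycleAdj⇒≢ xy) (λ adj → proj₂ (Adj⇒R adj) xy)

  ≡⊎CycleAdj⊎Adj : ∀ x y → x ≡ y ⊎ CycleAdj x y ⊎ Adj graph x y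
  ≡⊎CycleAdj⊎Adj x y = classify (x ≟ y) (CycleAdj? x y)
    where
    classify : Dec (x ≡ y) → Dec (CycleAdj x y) → x ≡ y ⊎ CycleAdj x y ⊎ Adj graph x y
    classify (yes x≡y) _        = inj₁ x≡y
    classify (no _)    (yes xy) = inj₂ (inj₁ xy)
    classify (no x≢y)  (no ¬xy) = inj₂ (inj₂ (R⇒Adj (x≢y , ¬xy)))

  diameter≤2 : Diameter≤ graph 2
  diameter≤2 x y with ≡⊎CycleAdj⊎Adj x y
  ... | inj₁ refl        = 0 , z≤n , here
  ... | inj₂ (inj₁ xy)   = 2 , ≤-refl , CycleAdj⇒walk₂ xy
  ... | inj₂ (inj₂ x~y)  = 1 , s≤s z≤n , step x~y here

  CycleAdj⇒MaxDist : CycleAdj x y → MaxDist graph x y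
  CycleAdj⇒MaxDist xy = MaxDist-at-diameter graph diameter≤2 (proj₂ (CycleAdj⇒Dist₂ xy))

  ¬Adj⇒≡⊎CycleAdj : ¬ Adj graph x y → x ≡ y ⊎ CycleAdj x y
  ¬Adj⇒≡⊎CycleAdj {x} {y} ¬x~y with ≡⊎CycleAdj⊎Adj x y
  ... | inj₁ x≡y        = inj₁ x≡y
  ... | inj₂ (inj₁ xy)  = inj₂ xy
  ... | inj₂ (inj₂ x~y) = ⊥-elim (¬x~y x~y)

  Adj⇒Adj-next⊎Adj-prev : Adj graph x y → Adj graph x (next y) ⊎ Adj graph x (prev y)
  Adj⇒Adj-next⊎Adj-prev {x} {y} xy with Adj? x (next y) | Adj? x (prev y)
  ... | yes x~y+1 | _         = inj₁ x~y+1
  ... | no _      | yes x~y-1 = inj₂ x~y-1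
  ... | no ¬x~y+1 | no ¬x~y-1 =
    ⊥-elim (gap (Adj⇒R xy) (¬Adj⇒≡⊎CycleAdj ¬x~y+1) (¬Adj⇒≡⊎CycleAdj ¬x~y-1))
    where
    open Equivalence
    gap : NonCycleAdj x y → x ≡ next y ⊎ CycleAdj x (next y) → x ≡ prev y ⊎ CycleAdj x (prev y) → ⊥
    gap (_ , ¬xy) (inj₁ x≡y+1) _ = ¬xy (from CycleAdj⇔next (inj₂ x≡y+1))
    gap (x≢y , ¬xy) (inj₂ c₊) p with to CycleAdj⇔next c₊ | p
    ... | inj₁ y+1≡x+1 | _ = x≢y (sym (next-injective y+1≡x+1))
    ... | inj₂ _ | inj₁ x≡y-1 =
      ¬xy (from CycleAdj⇔next (inj₁ (trans (sym (next-prev y)) (cong next (sym x≡y-1)))))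
    ... | inj₂ x≡y+2 | inj₂ c₋ with to CycleAdj⇔next c₋
    ...   | inj₂ x≡y = x≢y (trans x≡y (next-prev y))
    ...   | inj₁ y-1≡x+1 = next^-≢ 4 x (s≤s z≤n) (s≤s 4≤N) (sym (begin
            x                            ≡⟨ x≡y+2 ⟩
            next (next y)                ≡⟨ cong (λ z → next (next z)) (next-prev y) ⟨
            next (next (next (prev y)))  ≡⟨ cong (λ z → next (next (next z))) y-1≡x+1 ⟩
            next^ 4 x                    ∎))
      where open ≡-Reasoning

  Adj⇒¬MaxDist : Adj graph x y → ¬ MaxDist graph x y
  Adj⇒¬MaxDist {x} {y} xy with Adj⇒Adj-next⊎Adj-prev xy
  ... | inj₁ x~y+1 = farther-neighbour⇒¬MaxDist graph x~y+1
                       (CycleAdj⇒Dist₂ (CycleAdj-next y)) (Adj⇒Dist₁ graph xy) ≤-refl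
  ... | inj₂ x~y-1 = farther-neighbour⇒¬MaxDist graph x~y-1
                       (CycleAdj⇒Dist₂ (Equivalence.from CycleAdj⇔next (inj₂ (sym (next-prev y)))))
                       (Adj⇒Dist₁ graph xy) ≤-refl

  MMD⇔CycleAdj : ∀ x y → MMD graph x y ⇔ CycleAdj x y
  MMD⇔CycleAdj x y =
    mk⇔ MMD⇒CycleAdj (λ xy → CycleAdj⇒MaxDist xy , CycleAdj⇒MaxDist (CycleAdj-sym xy))
    where
    MMD⇒CycleAdj : MMD graph x y → CycleAdj x y
    MMD⇒CycleAdj (maxDist , _) with ≡⊎CycleAdj⊎Adj x y
    ... | inj₁ refl       = ⊥-elim (¬MaxDist-self graph (proj₁ (next^3-common-neighbour x)) maxDist)
    ... | inj₂ (inj₁ xy)  = xy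
    ... | inj₂ (inj₂ x~y) = ⊥-elim (Adj⇒¬MaxDist x~y maxDist)

  complement-SRIsoCycle : SRIsoCycle graph (suc N)
  complement-SRIsoCycle =
    MMD⇔CycleAdj⇒SRIsoCycle graph (λ i → i) (λ _ _ eq → eq) (λ u → u , refl) MMD⇔CycleAdj

proposition19 : (n : ℕ) → 3 ≤ n → n ≢ 4 →
    Σ Graph λ G → Connected G × SRIsoCycle G n
proposition19 1 (s≤s ()) _
proposition19 2 (s≤s (s≤s ())) _
proposition19 3 _ _ =
  complete 3 , Diameter≤⇒Connected (complete 3) complete-diameter≤1 , K₃-SRIsoCycle
proposition19 4 _ 4≢4 = ⊥-elim (4≢4 refl)
proposition19 (suc N@(suc (suc (suc (suc _))))) _ _ =
  graph , Diameter≤⇒Connected graph diameter≤2 , complement-SRIsoCycle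
  where open CycleComplement N (s≤s (s≤s (s≤s (s≤s z≤n))))
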